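{- Let $D_3:=\{\{1,2,3\},\{ -1,-2,-3\},\{ -1,2\},\{ -2,3\},\{ -3,1\}\}$. For $m\in\mathbb{N}$ define $K_m$ recursively: $K_1:=D_3$; $K_{m+1}$ is obtained by taking a copy $F'$ of $D_3$ (obtained by renaming variables) with $\mathrm{var}(F')\cap\mathrm{var}(K_m)=\emptyset$, a new variable $v\notin \mathrm{var}(K_m)\cup\mathrm{var}(F')$, and setting $K_{m+1}:=\{\{v\}\cup D: D\in K_m\}\cup\{\{\overline v\}\cup D: D\in F'\}$. Then $K_m$ is a nonsingular unsatisfiable hitting clause-set with $\delta(K_m)=m+1$ and $n(K_m)=3+(m-1)\cdot 4$. Consequently $\mathrm{N}(k)\ge 4k-5$ for all integers $k\ge 2$.
   Context: Variables are positive integers, literals are nonzero integers, the complement of $x$ is $\overline{x}=-x$. A clause is a finite set of literals with no pair $x,\overline{x}$; a clause-set is a finite set of clauses. $\mathrm{var}(F)$ is the set of variables occurring in $F$, $n(F)=|\mathrm{var}(F)|$, $c(F)=|F|$, $\delta(F)=c(F)-n(F)$. $F$ is satisfiable if some clause meets every clause of $F$, otherwise unsatisfiable. $F$ is hitting if any two distinct clauses $C,D\in F$ have some $x\in C$ with $\overline{x}\in D$. $\mathrm{ldeg}_F(x)$ is the number of clauses of $F$ containing $x$; a variable $v$ of $F$ is singular if $\min(\mathrm{ldeg}_F(v),\mathrm{ldeg}_F(\overline v))=1$; $F$ is nonsingular if it has no singular variables. $\mathrm{N}(k)\in\mathbb{N}_0\cup\{+\infty\}$ is the supremum of $n(F)$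 over nonsingular unsatisfiable hitting clause-sets $F$ with $\delta(F)=k$. -}

module Defs where

open import Data.Nat as ℕ using (ℕ; zero; suc; _⊓_)
open import Data.Integer as ℤ using (ℤ; +_; -_; ∣_∣)
open import Data.List using (List; []; _∷_; map; concat; length; filter; deduplicate; _++_)
open import Data.List.Membership.Propositional using (_∈_; _∉_)
open import Data.List.Membership.DecPropositional ℤ._≟_ using (_∈?_)
open import Data.List.Relation.Unary.All using (All)
open import Data.List.Relation.Unary.Unique.Propositional using (Unique)
open import Data.List.Relation.Unary.AllPairs using (AllPairs)
open import Data.List.Relation.Binary.Subset.Propositional using (_⊆_)
open import Data.Product using (_×_; ∃)
open import Relation.Binary.PropositionalEquality using (_≡_; _≢_)
open import Relation.Nullary using (¬_)

-- Literals are nonzero integers; variables are positive naturals.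
-- A clause is represented by a list of literals (read as a finite set),
-- a clause-set by a list of clauses (read as a finite set of clauses).
Literal : Set
Literal = ℤ

Clause : Set
Clause = List Literal

ClauseSet : Set
ClauseSet = List Clause

IsClause : Clause → Set
IsClause C = All (λ x → x ≢ + 0) C × Unique C × All (λ x → - x ∉ C) C

_≈C_ : Clause → Clause → Set
C ≈C D = C ⊆ D × D ⊆ C

-- well-formed clause-set: every clause well-formed, clauses pairwise distinct as sets
-- (so that the list length is the number of clauses)
IsClauseSet : ClauseSet → Set
IsClauseSet F = All IsClause F × AllPairs (λ C D → ¬ (C ≈C D)) F

vars : ClauseSet → List ℕ
vars F = deduplicate ℕ._≟_ (map ∣_∣ (concat F))

n : ClauseSet → ℕ
n F = length (vars F)

c : ClauseSet → ℕ
c F = length F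

δ : ClauseSet → ℤ
δ F = + c F ℤ.- + n F

Satisfiable : ClauseSet → Set
Satisfiable F = ∃ λ C → IsClause C × All (λ D → ∃ λ x → x ∈ C × x ∈ D) F

Hitting : ClauseSet → Set
Hitting F = AllPairs (λ C D → ∃ λ x → x ∈ C × - x ∈ D) F

ldeg : ClauseSet → Literal → ℕ
ldeg F x = length (filter (x ∈?_) F)

Singular : ClauseSet → ℕ → Set
Singular F v = v ∈ vars F × (ldeg F (+ v) ⊓ ldeg F (- + v)) ≡ 1

Nonsingular : ClauseSet → Set
Nonsingular F = ∀ v → ¬ Singular F v

D₃ : ClauseSet
D₃ = (+ 1 ∷ + 2 ∷ + 3 ∷ [])
   ∷ (- + 1 ∷ - + 2 ∷ - + 3 ∷ [])
   ∷ (- + 1 ∷ + 2 ∷ [])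
   ∷ (- + 2 ∷ + 3 ∷ [])
   ∷ (- + 3 ∷ + 1 ∷ [])
   ∷ []

copyD₃ : ℕ → ℕ → ℕ → ClauseSet
copyD₃ a b c' = (+ a ∷ + b ∷ + c' ∷ [])
   ∷ (- + a ∷ - + b ∷ - + c' ∷ [])
   ∷ (- + a ∷ + b ∷ [])
   ∷ (- + b ∷ + c' ∷ [])
   ∷ (- + c' ∷ + a ∷ [])
   ∷ []

-- IsK m F : F is (a possible result of) the construction K_m,
-- for any admissible choice of the copy F' and the new variable v.
data IsK : ℕ → ClauseSet → Set where
  base : IsK 1 D₃
  step : ∀ {m K} → IsK m K → (a b c' v : ℕ) →
         a ≢ 0 → b ≢ 0 → c' ≢ 0 → v ≢ 0 →
         a ≢ b → a ≢ c' → b ≢ c' → v ≢ a → v ≢ b → v ≢ c' →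
         a ∉ vars K → b ∉ vars K → c' ∉ vars K → v ∉ vars K →
         IsK (suc m)
             (map (+ v ∷_) K ++ map (- + v ∷_) (copyD₃ a b c'))

module Submission where

-- D₃ is unsatisfiable and hitting, and each of its literals occurs at least twice.
-- Branching on a new variable v (adding v to every clause of K and v̄ to every
-- clause of a variable-disjoint G) preserves all three properties: a clause
-- meeting every clause of the result either contains v, and then meets every
-- clause of G, or it does not, and then meets every clause of K. Each step adds
-- five clauses and four variables, so c(Kₘ) = 5m and n(Kₘ) + 1 = 4m.

open import Defs
open import Data.Nat using (ℕ; _+_; _*_; _∸_; _≤_)
open import Data.Integer using (+_)
open import Data.Product using (_×_; ∃)
open import Relation.Binary.PropositionalEquality using (_≡_)
open import Relation.Nullary using (¬_)

open import Data.Nat using (zero; suc; s≤s; z≤n; _<_)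
open import Data.Nat.Properties
  using (≤-refl; ≤-trans; ≤-reflexive; n≤1+n; m≤m+n; m≤n+m; m≤n⇒m≤1+n; <⇒≱;
         +-comm; *-suc; +-cancelʳ-≡; m+n∸m≡n; m+1+n≢0; m≢1+n+m; ⊓-glb)
open import Data.Nat.ListAction using (sum)
open import Data.Nat.Tactic.RingSolver using (solve-∀)
open import Data.Integer using (ℤ; -[1+_]; -_; ∣_∣; _-_; _⊖_)
open import Data.Integer.Properties using (+-injective; m-n≡m⊖n; ⊖-≥; neg-involutive; ∣-i∣≡∣i∣)
open import Data.List using (List; []; _∷_; map; concat; length; _++_)
open import Data.List.Properties using (length-++; length-map)
open import Data.List.Membership.Propositional using (_∈_; _∉_)
open import Data.List.Membership.Propositional.Properties
  using (∈-map⁺; ∈-map⁻; ∈-++⁺ˡ; ∈-++⁺ʳ; ∈-++⁻; ∈-concat⁺′; ∈-concat⁻′; ∈-deduplicate⁺; ∈-deduplicate⁻)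
open import Data.List.Membership.Propositional.Properties.WithK using (unique∧set⇒bag)
open import Data.List.Membership.DecPropositional Data.Integer._≟_ using (_∈?_)
open import Data.List.Relation.Binary.BagAndSetEquality using (∼bag⇒↭)
open import Data.List.Relation.Binary.Permutation.Propositional.Properties using (↭-length)
open import Data.List.Relation.Binary.Subset.Propositional using (_⊆_)
open import Data.List.Relation.Unary.Any using (here; there)
open import Data.List.Relation.Unary.All as All using (All; []; _∷_)
open import Data.List.Relation.Unary.All.Properties as All using (All¬⇒¬Any; ¬Any⇒All¬)
open import Data.List.Relation.Unary.AllPairs as AllPairs using (AllPairs; []; _∷_)
import Data.List.Relation.Unary.AllPairs.Properties as AllPairs
open import Data.List.Relation.Unary.Unique.Propositional using (Unique)
import Data.List.Relation.Unary.Unique.Propositional.Properties as Unique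
open import Data.List.Relation.Unary.Unique.DecPropositional.Properties Data.Nat._≟_ using (deduplicate-!)
open import Data.Product as Product using (_,_)
open import Data.Sum using (_⊎_; inj₁; inj₂; [_,_])
open import Data.Empty using (⊥-elim)
open import Function using (_∘_)
open import Function.Bundles using (mk⇔)
open import Relation.Binary.PropositionalEquality using (_≢_; refl; sym; trans; cong; cong₂; subst; ≢-sym; module ≡-Reasoning)
open import Relation.Nullary using (yes; no)

+≢0 : ∀ {a} → a ≢ 0 → + a ≢ + 0
+≢0 a≢0 = a≢0 ∘ +-injective

-+≢0 : ∀ {a} → a ≢ 0 → - + a ≢ + 0
-+≢0 {zero} a≢0 _ = a≢0 refl
-+≢0 {suc a} _ ()

∣-+∣ : ∀ a → ∣ - + a ∣ ≡ a
∣-+∣ a = ∣-i∣≡∣i∣ (+ a)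

-≡⇒≡0 : ∀ {x : ℤ} → - x ≡ x → x ≡ + 0
-≡⇒≡0 { + zero } _ = refl
-≡⇒≡0 { + suc _ } ()
-≡⇒≡0 { -[1+ _ ] } ()

IsClause-∷ : ∀ {l C} → IsClause C → l ≢ + 0 → l ∉ C → - l ∉ C → IsClause (l ∷ C)
IsClause-∷ {l} {C} (nonzero , unique , noClash) l≢0 l∉C -l∉C =
    l≢0 ∷ nonzero
  , ¬Any⇒All¬ C l∉C ∷ unique
  , [-l]∉l∷C ∷ All.map [-x]∉l∷C (All.tabulate (λ x∈C → x∈C , All.lookup noClash x∈C))
  where
  [-l]∉l∷C : - l ∉ l ∷ C
  [-l]∉l∷C (here -l≡l) = l≢0 (-≡⇒≡0 -l≡l)
  [-l]∉l∷C (there -l∈C) = -l∉C -l∈C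
  [-x]∉l∷C : ∀ {x} → x ∈ C × - x ∉ C → - x ∉ l ∷ C
  [-x]∉l∷C {x} (x∈C , _) (here -x≡l) = -l∉C (subst (_∈ C) (trans (sym (neg-involutive x)) (cong -_ -x≡l)) x∈C)
  [-x]∉l∷C (_ , -x∉C) (there -x∈C) = -x∉C -x∈C

distinctVars⇒IsClause : ∀ {C} → All (_≢ + 0) C → Unique (map ∣_∣ C) → IsClause C
distinctVars⇒IsClause {[]} [] [] = [] , [] , []
distinctVars⇒IsClause {l ∷ C} (l≢0 ∷ nonzero) (∣l∣∉ ∷ unique) =
  IsClause-∷ (distinctVars⇒IsClause nonzero unique) l≢0
    (λ l∈C → ∣l∣∉C (∈-map⁺ ∣_∣ l∈C))
    (λ -l∈C → ∣l∣∉C (subst (_∈ map ∣_∣ C) (∣-i∣≡∣i∣ l) (∈-map⁺ ∣_∣ -l∈C)))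
  where
  ∣l∣∉C : ∣ l ∣ ∉ map ∣_∣ C
  ∣l∣∉C = All¬⇒¬Any ∣l∣∉

∈-vars⁻ : ∀ {F u} → u ∈ vars F → ∃ λ C → C ∈ F × ∃ λ x → x ∈ C × ∣ x ∣ ≡ u
∈-vars⁻ {F} u∈F with ∈-map⁻ ∣_∣ (∈-deduplicate⁻ Data.Nat._≟_ (map ∣_∣ (concat F)) u∈F)
... | x , x∈F , u≡∣x∣ with ∈-concat⁻′ F x∈F
... | C , x∈C , C∈F = C , C∈F , x , x∈C , sym u≡∣x∣

∈-vars⁺ : ∀ {F C x} → C ∈ F → x ∈ C → ∣ x ∣ ∈ vars F
∈-vars⁺ C∈F x∈C = ∈-deduplicate⁺ Data.Nat._≟_ (∈-map⁺ ∣_∣ (∈-concat⁺′ x∈C C∈F))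

vars-unique : ∀ F → Unique (vars F)
vars-unique F = deduplicate-! (map ∣_∣ (concat F))

length-unique-⊆⊇ : ∀ {xs ys : List ℕ} → Unique xs → Unique ys → xs ⊆ ys → ys ⊆ xs →
                   length xs ≡ length ys
length-unique-⊆⊇ xs! ys! xs⊆ys ys⊆xs = ↭-length (∼bag⇒↭ (unique∧set⇒bag xs! ys! (mk⇔ xs⊆ys ys⊆xs)))

ldeg-∷-∈ : ∀ {x C} F → x ∈ C → ldeg (C ∷ F) x ≡ suc (ldeg F x)
ldeg-∷-∈ {x} {C} F x∈C with x ∈? C
... | yes _ = refl
... | no x∉C = ⊥-elim (x∉C x∈C)

ldeg-∷-≤ : ∀ {x} C F → ldeg F x ≤ ldeg (C ∷ F) x
ldeg-∷-≤ {x} C F with x ∈? C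
... | yes _ = n≤1+n _
... | no _ = ≤-refl

ldeg-++ : ∀ {x} A B → ldeg (A ++ B) x ≡ ldeg A x + ldeg B x
ldeg-++ [] B = refl
ldeg-++ {x} (C ∷ A) B with x ∈? C
... | yes _ = cong suc (ldeg-++ A B)
... | no _ = ldeg-++ A B

ldeg-++-≤ˡ : ∀ {x} A B → ldeg A x ≤ ldeg (A ++ B) x
ldeg-++-≤ˡ {x} A B = subst (ldeg A x ≤_) (sym (ldeg-++ A B)) (m≤m+n _ _)

ldeg-++-≤ʳ : ∀ {x} A B → ldeg B x ≤ ldeg (A ++ B) x
ldeg-++-≤ʳ {x} A B = subst (ldeg B x ≤_) (sym (ldeg-++ A B)) (m≤n+m _ _)

ldeg-∷-mono : ∀ {x C D F G} → (x ∈ C → x ∈ D) → ldeg F x ≤ ldeg G x → ldeg (C ∷ F) x ≤ ldeg (D ∷ G) x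
ldeg-∷-mono {x} {C} {D} C⊆D F≤G with x ∈? C | x ∈? D
... | yes _ | yes _ = s≤s F≤G
... | yes x∈C | no x∉D = ⊥-elim (x∉D (C⊆D x∈C))
... | no _ | yes _ = m≤n⇒m≤1+n F≤G
... | no _ | no _ = F≤G

ldeg-map-∷-≤ : ∀ {x} y F → ldeg F x ≤ ldeg (map (y ∷_) F) x
ldeg-map-∷-≤ y [] = z≤n
ldeg-map-∷-≤ y (C ∷ F) = ldeg-∷-mono {C = C} {y ∷ C} there (ldeg-map-∷-≤ y F)

ldeg-map-∷-self : ∀ {x} F → ldeg (map (x ∷_) F) x ≡ length F
ldeg-map-∷-self [] = refl
ldeg-map-∷-self {x} (C ∷ F) = trans (ldeg-∷-∈ (map (x ∷_) F) (here refl)) (cong suc (ldeg-map-∷-self F))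

ldeg-≥1 : ∀ {x C F} → C ∈ F → x ∈ C → 1 ≤ ldeg F x
ldeg-≥1 {F = D ∷ F} (here refl) x∈D = ≤-trans (s≤s z≤n) (≤-reflexive (sym (ldeg-∷-∈ F x∈D)))
ldeg-≥1 {F = D ∷ F} (there C∈F) x∈C = ≤-trans (ldeg-≥1 C∈F x∈C) (ldeg-∷-≤ D F)

ldeg-∷-≥2 : ∀ {x C D F} → x ∈ C → D ∈ F → x ∈ D → 2 ≤ ldeg (C ∷ F) x
ldeg-∷-≥2 {F = F} x∈C D∈F x∈D = ≤-trans (s≤s (ldeg-≥1 D∈F x∈D)) (≤-reflexive (sym (ldeg-∷-∈ F x∈C)))

record IsNonsingularUHit (F : ClauseSet) : Set where
  field
    clauses : All IsClause F
    hitting : Hitting F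
    unsatisfiable : ¬ Satisfiable F
    ldeg≥2 : ∀ {u} → u ∈ vars F → 2 ≤ ldeg F (+ u) × 2 ≤ ldeg F (- + u)
    -- the branching variable of a branch on K and G occurs c K times positively and c G times negatively
    c≥2 : 2 ≤ c F

hitting⇒distinct : ∀ {F} → All IsClause F → Hitting F → AllPairs (λ C D → ¬ (C ≈C D)) F
hitting⇒distinct [] [] = []
hitting⇒distinct ((_ , _ , noClash) ∷ clauses) (clashes ∷ hitting) =
  All.map (λ { (x , x∈C , -x∈D) (_ , D⊆C) → All.lookup noClash x∈C (D⊆C -x∈D) }) clashes
  ∷ hitting⇒distinct clauses hitting

module _ {F} (F-NUH : IsNonsingularUHit F) where
  open IsNonsingularUHit F-NUH

  IsNonsingularUHit⇒IsClauseSet : IsClauseSet F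
  IsNonsingularUHit⇒IsClauseSet = clauses , hitting⇒distinct clauses hitting

  IsNonsingularUHit⇒Nonsingular : Nonsingular F
  IsNonsingularUHit⇒Nonsingular u (u∈F , min≡1) with ldeg≥2 u∈F
  ... | pos≥2 , neg≥2 with subst (2 ≤_) min≡1 (⊓-glb pos≥2 neg≥2)
  ... | s≤s ()

c≡n+k⇒δ≡k : ∀ F k → c F ≡ n F + k → δ F ≡ + k
c≡n+k⇒δ≡k F k c≡n+k = begin
  + c F - + n F        ≡⟨ m-n≡m⊖n (c F) (n F) ⟩
  c F ⊖ n F            ≡⟨ cong (_⊖ n F) c≡n+k ⟩
  (n F + k) ⊖ n F      ≡⟨ ⊖-≥ (m≤m+n (n F) k) ⟩
  + (n F + k ∸ n F)    ≡⟨ cong +_ (m+n∸m≡n (n F) k) ⟩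
  + k                  ∎
  where open ≡-Reasoning

-- Copies of D₃

module CopyD₃ {a b c : ℕ} (a≢0 : a ≢ 0) (b≢0 : b ≢ 0) (c≢0 : c ≢ 0)
              (a≢b : a ≢ b) (a≢c : a ≢ c) (b≢c : b ≢ c) where

  all⁺ all⁻ : Clause
  all⁺ = + a ∷ + b ∷ + c ∷ []
  all⁻ = - + a ∷ - + b ∷ - + c ∷ []

  binaries : ClauseSet
  binaries = (- + a ∷ + b ∷ []) ∷ (- + b ∷ + c ∷ []) ∷ (- + c ∷ + a ∷ []) ∷ []

  abc-unique : Unique (a ∷ b ∷ c ∷ [])
  abc-unique = (a≢b ∷ a≢c ∷ []) ∷ (b≢c ∷ []) ∷ [] ∷ []

  binary-unique : ∀ {x y} → x ≢ y → Unique (∣ - + x ∣ ∷ y ∷ [])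
  binary-unique {x} x≢y rewrite ∣-+∣ x = (x≢y ∷ []) ∷ [] ∷ []

  negated-unique : Unique (map ∣_∣ all⁻)
  negated-unique rewrite ∣-+∣ a | ∣-+∣ b | ∣-+∣ c = abc-unique

  clauses : All IsClause (copyD₃ a b c)
  clauses =
      distinctVars⇒IsClause (+≢0 a≢0 ∷ +≢0 b≢0 ∷ +≢0 c≢0 ∷ []) abc-unique
    ∷ distinctVars⇒IsClause (-+≢0 a≢0 ∷ -+≢0 b≢0 ∷ -+≢0 c≢0 ∷ []) negated-unique
    ∷ distinctVars⇒IsClause (-+≢0 a≢0 ∷ +≢0 b≢0 ∷ []) (binary-unique a≢b)
    ∷ distinctVars⇒IsClause (-+≢0 b≢0 ∷ +≢0 c≢0 ∷ []) (binary-unique b≢c)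
    ∷ distinctVars⇒IsClause (-+≢0 c≢0 ∷ +≢0 a≢0 ∷ []) (binary-unique (≢-sym a≢c))
    ∷ []

  hitting : Hitting (copyD₃ a b c)
  hitting =
      ( (+ a , here refl , here refl)
      ∷ (+ a , here refl , here refl)
      ∷ (+ b , there (here refl) , here refl)
      ∷ (+ c , there (there (here refl)) , here refl) ∷ [])
    ∷ ( (- + b , there (here refl) , there (here (neg-involutive (+ b))))
      ∷ (- + c , there (there (here refl)) , there (here (neg-involutive (+ c))))
      ∷ (- + a , here refl , there (here (neg-involutive (+ a)))) ∷ [])
    ∷ ( (+ b , there (here refl) , here refl)
      ∷ (- + a , here refl , there (here (neg-involutive (+ a)))) ∷ [])
    ∷ ((+ c , there (here refl) , here refl) ∷ [])
    ∷ [] ∷ []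

  unsatisfiable : ¬ Satisfiable (copyD₃ a b c)
  unsatisfiable (C , (_ , _ , noClash) , all⁺∩C ∷ all⁻∩C ∷ a⇒b ∷ b⇒c ∷ c⇒a ∷ []) = noNegative all⁻∩C
    where
    clash : ∀ {x} → x ∈ C → - x ∉ C
    clash = All.lookup noClash
    implication : ∀ {x y} → ∃ (λ z → z ∈ C × z ∈ (- + x ∷ + y ∷ [])) → + x ∈ C → + y ∈ C
    implication (_ , -x∈C , here refl) +x∈C = ⊥-elim (clash +x∈C -x∈C)
    implication (_ , +y∈C , there (here refl)) _ = +y∈C
    somePositive⇒+a∈C : ∃ (λ z → z ∈ C × z ∈ all⁺) → + a ∈ C
    somePositive⇒+a∈C (_ , +a∈C , here refl) = +a∈C
    somePositive⇒+a∈C (_ , +b∈C , there (here refl)) = implication c⇒a (implication b⇒c +b∈C)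
    somePositive⇒+a∈C (_ , +c∈C , there (there (here refl))) = implication c⇒a +c∈C
    +a∈C : + a ∈ C
    +a∈C = somePositive⇒+a∈C all⁺∩C
    +b∈C : + b ∈ C
    +b∈C = implication a⇒b +a∈C
    +c∈C : + c ∈ C
    +c∈C = implication b⇒c +b∈C
    noNegative : ¬ ∃ (λ z → z ∈ C × z ∈ all⁻)
    noNegative (_ , -a∈C , here refl) = clash +a∈C -a∈C
    noNegative (_ , -b∈C , there (here refl)) = clash +b∈C -b∈C
    noNegative (_ , -c∈C , there (there (here refl))) = clash +c∈C -c∈C

  vars⊆abc : vars (copyD₃ a b c) ⊆ a ∷ b ∷ c ∷ []
  vars⊆abc u∈vars with ∈-vars⁻ {copyD₃ a b c} u∈vars
  ... | C , C∈ , x , x∈C , refl = All.lookup (All.lookup literals⊆abc C∈) x∈C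
    where
    -a∈ : ∣ - + a ∣ ∈ a ∷ b ∷ c ∷ []
    -a∈ = here (∣-+∣ a)
    -b∈ : ∣ - + b ∣ ∈ a ∷ b ∷ c ∷ []
    -b∈ = there (here (∣-+∣ b))
    -c∈ : ∣ - + c ∣ ∈ a ∷ b ∷ c ∷ []
    -c∈ = there (there (here (∣-+∣ c)))
    literals⊆abc : All (All (λ x → ∣ x ∣ ∈ a ∷ b ∷ c ∷ [])) (copyD₃ a b c)
    literals⊆abc = (here refl ∷ there (here refl) ∷ there (there (here refl)) ∷ [])
                 ∷ (-a∈ ∷ -b∈ ∷ -c∈ ∷ [])
                 ∷ (-a∈ ∷ there (here refl) ∷ [])
                 ∷ (-b∈ ∷ there (there (here refl)) ∷ [])
                 ∷ (-c∈ ∷ here refl ∷ [])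
                 ∷ []

  abc⊆vars : a ∷ b ∷ c ∷ [] ⊆ vars (copyD₃ a b c)
  abc⊆vars (here refl) = ∈-vars⁺ {copyD₃ a b c} (here refl) (here refl)
  abc⊆vars (there (here refl)) = ∈-vars⁺ {copyD₃ a b c} (here refl) (there (here refl))
  abc⊆vars (there (there (here refl))) = ∈-vars⁺ {copyD₃ a b c} (here refl) (there (there (here refl)))

  n≡3 : n (copyD₃ a b c) ≡ 3
  n≡3 = length-unique-⊆⊇ (vars-unique (copyD₃ a b c)) abc-unique vars⊆abc abc⊆vars

  positive≥2 : ∀ {x D} → x ∈ all⁺ → D ∈ all⁻ ∷ binaries → x ∈ D → 2 ≤ ldeg (copyD₃ a b c) x
  positive≥2 = ldeg-∷-≥2

  negative≥2 : ∀ {x D} → x ∈ all⁻ → D ∈ binaries → x ∈ D → 2 ≤ ldeg (copyD₃ a b c) x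
  negative≥2 {x} x∈all⁻ D∈ x∈D = ≤-trans (ldeg-∷-≥2 x∈all⁻ D∈ x∈D) (ldeg-∷-≤ {x} all⁺ (all⁻ ∷ binaries))

  ldeg≥2 : ∀ {u} → u ∈ vars (copyD₃ a b c) → 2 ≤ ldeg (copyD₃ a b c) (+ u) × 2 ≤ ldeg (copyD₃ a b c) (- + u)
  ldeg≥2 u∈vars with vars⊆abc u∈vars
  ... | here refl =
      positive≥2 (here refl) (there (there (there (here refl)))) (there (here refl))
    , negative≥2 (here refl) (here refl) (here refl)
  ... | there (here refl) =
      positive≥2 (there (here refl)) (there (here refl)) (there (here refl))
    , negative≥2 (there (here refl)) (there (here refl)) (here refl)
  ... | there (there (here refl)) =
      positive≥2 (there (there (here refl))) (there (there (here refl))) (there (here refl))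
    , negative≥2 (there (there (here refl))) (there (there (here refl))) (here refl)

  isNonsingularUHit : IsNonsingularUHit (copyD₃ a b c)
  isNonsingularUHit = record
    { clauses = clauses ; hitting = hitting ; unsatisfiable = unsatisfiable
    ; ldeg≥2 = ldeg≥2 ; c≥2 = s≤s (s≤s z≤n) }

-- Branching on a new variable

branch : ℕ → ClauseSet → ClauseSet → ClauseSet
branch v K G = map (+ v ∷_) K ++ map (- + v ∷_) G

c-branch : ∀ v K G → c (branch v K G) ≡ c K + c G
c-branch v K G = begin
  length (map (+ v ∷_) K ++ map (- + v ∷_) G)         ≡⟨ length-++ (map (+ v ∷_) K) ⟩
  length (map (+ v ∷_) K) + length (map (- + v ∷_) G) ≡⟨ cong₂ _+_ (length-map (+ v ∷_) K) (length-map (- + v ∷_) G) ⟩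
  length K + length G                                 ∎
  where open ≡-Reasoning

vars-branch⁻ : ∀ {v K G u} → u ∈ vars (branch v K G) → u ≡ v ⊎ u ∈ vars K ⊎ u ∈ vars G
vars-branch⁻ {v} {K} {G} u∈ with ∈-vars⁻ {branch v K G} u∈
... | C , C∈ , x , x∈C , refl with ∈-++⁻ (map (+ v ∷_) K) C∈
...   | inj₁ C∈K⁺ with ∈-map⁻ (+ v ∷_) C∈K⁺
...     | D , D∈K , refl with x∈C
...       | here refl = inj₁ refl
...       | there x∈D = inj₂ (inj₁ (∈-vars⁺ {K} D∈K x∈D))
vars-branch⁻ {v} {K} {G} u∈ | C , C∈ , x , x∈C , refl | inj₂ C∈G⁻ with ∈-map⁻ (- + v ∷_) C∈G⁻
...     | D , D∈G , refl with x∈C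
...       | here refl = inj₁ (∣-+∣ v)
...       | there x∈D = inj₂ (inj₂ (∈-vars⁺ {G} D∈G x∈D))

vars-branch⁺ : ∀ {v K G u} → u ∈ vars K ⊎ u ∈ vars G → u ∈ vars (branch v K G)
vars-branch⁺ {v} {K} {G} (inj₁ u∈K) with ∈-vars⁻ {K} u∈K
... | C , C∈K , x , x∈C , refl = ∈-vars⁺ {branch v K G} (∈-++⁺ˡ (∈-map⁺ (+ v ∷_) C∈K)) (there x∈C)
vars-branch⁺ {v} {K} {G} (inj₂ u∈G) with ∈-vars⁻ {G} u∈G
... | C , C∈G , x , x∈C , refl =
  ∈-vars⁺ {branch v K G} (∈-++⁺ʳ (map (+ v ∷_) K) (∈-map⁺ (- + v ∷_) C∈G)) (there x∈C)

v∈vars-branch : ∀ {v K G} → 0 < c K → v ∈ vars (branch v K G)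
v∈vars-branch {v} {C ∷ K} {G} _ = ∈-vars⁺ {branch v (C ∷ K) G} (here refl) (here refl)

meets-∷⁻ : ∀ {C D : Clause} {l} → l ∉ C → ∃ (λ x → x ∈ C × x ∈ l ∷ D) → ∃ λ x → x ∈ C × x ∈ D
meets-∷⁻ l∉C (_ , l∈C , here refl) = ⊥-elim (l∉C l∈C)
meets-∷⁻ _ (x , x∈C , there x∈D) = x , x∈C , x∈D

module Branch {v K G} (v≢0 : v ≢ 0) (v∉K : v ∉ vars K) (v∉G : v ∉ vars G)
              (G∩K≡∅ : ∀ {u} → u ∈ vars G → u ∉ vars K)
              (K-NUH : IsNonsingularUHit K) (G-NUH : IsNonsingularUHit G) where
  private
    module K = IsNonsingularUHit K-NUH
    module G = IsNonsingularUHit G-NUH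

  +v∉ : ∀ {X C} → v ∉ vars X → C ∈ X → + v ∉ C
  +v∉ {X} v∉X C∈X +v∈C = v∉X (∈-vars⁺ {X} C∈X +v∈C)

  -v∉ : ∀ {X C} → v ∉ vars X → C ∈ X → - + v ∉ C
  -v∉ {X} v∉X C∈X -v∈C = v∉X (subst (_∈ vars X) (∣-+∣ v) (∈-vars⁺ {X} C∈X -v∈C))

  -[-v]∉ : ∀ {X C} → v ∉ vars X → C ∈ X → - - + v ∉ C
  -[-v]∉ {X} {C} v∉X C∈X = subst (_∉ C) (sym (neg-involutive (+ v))) (+v∉ v∉X C∈X)

  clauses : All IsClause (branch v K G)
  clauses = All.++⁺
    (All.map⁺ (All.tabulate λ C∈K →
      IsClause-∷ (All.lookup K.clauses C∈K) (+≢0 v≢0) (+v∉ v∉K C∈K) (-v∉ v∉K C∈K)))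
    (All.map⁺ (All.tabulate λ C∈G →
      IsClause-∷ (All.lookup G.clauses C∈G) (-+≢0 v≢0) (-v∉ v∉G C∈G) (-[-v]∉ v∉G C∈G)))

  hitting : Hitting (branch v K G)
  hitting = AllPairs.++⁺ (AllPairs.map⁺ (AllPairs.map extend K.hitting))
                         (AllPairs.map⁺ (AllPairs.map extend G.hitting))
                         (All.map⁺ (All.tabulate λ _ → All.map⁺ (All.tabulate λ _ → + v , here refl , here refl)))
    where
    extend : ∀ {l C D} → ∃ (λ x → x ∈ C × - x ∈ D) → ∃ λ x → x ∈ l ∷ C × - x ∈ l ∷ D
    extend (x , x∈C , -x∈D) = x , there x∈C , there -x∈D

  unsatisfiable : ¬ Satisfiable (branch v K G)
  unsatisfiable (C , C-clause@(_ , _ , noClash) , meetsAll) with All.++⁻ (map (+ v ∷_) K) meetsAll | + v ∈? C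
  ... | _ , meetsG | yes +v∈C =
    G.unsatisfiable (C , C-clause , All.map (meets-∷⁻ (All.lookup noClash +v∈C)) (All.map⁻ meetsG))
  ... | meetsK , _ | no +v∉C =
    K.unsatisfiable (C , C-clause , All.map (meets-∷⁻ +v∉C) (All.map⁻ meetsK))

  ldeg-K≤ : ∀ {x} → ldeg K x ≤ ldeg (branch v K G) x
  ldeg-K≤ = ≤-trans (ldeg-map-∷-≤ (+ v) K) (ldeg-++-≤ˡ (map (+ v ∷_) K) _)

  ldeg-G≤ : ∀ {x} → ldeg G x ≤ ldeg (branch v K G) x
  ldeg-G≤ = ≤-trans (ldeg-map-∷-≤ (- + v) G) (ldeg-++-≤ʳ (map (+ v ∷_) K) _)

  ldeg≥2 : ∀ {u} → u ∈ vars (branch v K G) →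
           2 ≤ ldeg (branch v K G) (+ u) × 2 ≤ ldeg (branch v K G) (- + u)
  ldeg≥2 u∈ with vars-branch⁻ {v} {K} {G} u∈
  ... | inj₁ refl =
      ≤-trans K.c≥2 (≤-trans (≤-reflexive (sym (ldeg-map-∷-self K))) (ldeg-++-≤ˡ (map (+ v ∷_) K) _))
    , ≤-trans G.c≥2 (≤-trans (≤-reflexive (sym (ldeg-map-∷-self G))) (ldeg-++-≤ʳ (map (+ v ∷_) K) _))
  ... | inj₂ (inj₁ u∈K) = Product.map (λ 2≤ → ≤-trans 2≤ ldeg-K≤) (λ 2≤ → ≤-trans 2≤ ldeg-K≤) (K.ldeg≥2 u∈K)
  ... | inj₂ (inj₂ u∈G) = Product.map (λ 2≤ → ≤-trans 2≤ ldeg-G≤) (λ 2≤ → ≤-trans 2≤ ldeg-G≤) (G.ldeg≥2 u∈G)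

  isNonsingularUHit : IsNonsingularUHit (branch v K G)
  isNonsingularUHit = record
    { clauses = clauses ; hitting = hitting ; unsatisfiable = unsatisfiable ; ldeg≥2 = ldeg≥2
    ; c≥2 = ≤-trans K.c≥2 (≤-trans (m≤m+n (c K) (c G)) (≤-reflexive (sym (c-branch v K G)))) }

  n-branch : n (branch v K G) ≡ suc (n K + n G)
  n-branch = begin
    length (vars (branch v K G))       ≡⟨ length-unique-⊆⊇ (vars-unique (branch v K G)) v∷K++G-unique ⊆v∷K++G v∷K++G⊆ ⟩
    length (v ∷ vars K ++ vars G)      ≡⟨ cong suc (length-++ (vars K)) ⟩
    suc (n K + n G)                    ∎
    where
    open ≡-Reasoning
    v∷K++G-unique : Unique (v ∷ vars K ++ vars G)
    v∷K++G-unique = ¬Any⇒All¬ _ (λ v∈K++G → [ v∉K , v∉G ] (∈-++⁻ (vars K) v∈K++G))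
                  ∷ Unique.++⁺ (vars-unique K) (vars-unique G) (λ (u∈K , u∈G) → G∩K≡∅ u∈G u∈K)
    ⊆v∷K++G : vars (branch v K G) ⊆ v ∷ vars K ++ vars G
    ⊆v∷K++G u∈ with vars-branch⁻ {v} {K} {G} u∈
    ... | inj₁ refl = here refl
    ... | inj₂ (inj₁ u∈K) = there (∈-++⁺ˡ u∈K)
    ... | inj₂ (inj₂ u∈G) = there (∈-++⁺ʳ (vars K) u∈G)
    v∷K++G⊆ : v ∷ vars K ++ vars G ⊆ vars (branch v K G)
    v∷K++G⊆ (here refl) = v∈vars-branch {v} {K} {G} (≤-trans (n≤1+n 1) K.c≥2)
    v∷K++G⊆ (there u∈K++G) = vars-branch⁺ {v} {K} {G} (∈-++⁻ (vars K) u∈K++G)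

-- The clause-sets Kₘ

suc[x+3]+1≡[x+1]+4 : ∀ x → suc (x + 3) + 1 ≡ (x + 1) + 4
suc[x+3]+1≡[x+1]+4 = solve-∀

IsK⇒invariants : ∀ {m F} → IsK m F → IsNonsingularUHit F × c F ≡ 5 * m × n F + 1 ≡ 4 * m
IsK⇒invariants base = CopyD₃.isNonsingularUHit {1} {2} {3} (λ ()) (λ ()) (λ ()) (λ ()) (λ ()) (λ ()) , refl , refl
IsK⇒invariants (step {m} {K} K-is-K a b c' v a≢0 b≢0 c'≢0 v≢0 a≢b a≢c' b≢c' v≢a v≢b v≢c' a∉K b∉K c'∉K v∉K)
  with IsK⇒invariants K-is-K
... | K-NUH , cK≡5m , nK+1≡4m = Branch.isNonsingularUHit v≢0 v∉K v∉G G∩K≡∅ K-NUH G.isNonsingularUHit , cF≡ , nF+1≡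
  where
  module G = CopyD₃ a≢0 b≢0 c'≢0 a≢b a≢c' b≢c'
  v∉G : v ∉ vars (copyD₃ a b c')
  v∉G v∈G with G.vars⊆abc v∈G
  ... | here v≡a = v≢a v≡a
  ... | there (here v≡b) = v≢b v≡b
  ... | there (there (here v≡c')) = v≢c' v≡c'
  G∩K≡∅ : ∀ {u} → u ∈ vars (copyD₃ a b c') → u ∉ vars K
  G∩K≡∅ u∈G with G.vars⊆abc u∈G
  ... | here refl = a∉K
  ... | there (here refl) = b∉K
  ... | there (there (here refl)) = c'∉K
  open ≡-Reasoning
  cF≡ : c (branch v K (copyD₃ a b c')) ≡ 5 * suc m
  cF≡ = begin
    c (branch v K (copyD₃ a b c'))  ≡⟨ c-branch v K (copyD₃ a b c') ⟩
    c K + 5                         ≡⟨ cong (_+ 5) cK≡5m ⟩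
    5 * m + 5                       ≡⟨ +-comm (5 * m) 5 ⟩
    5 + 5 * m                       ≡⟨ *-suc 5 m ⟨
    5 * suc m                       ∎
  nF+1≡ : n (branch v K (copyD₃ a b c')) + 1 ≡ 4 * suc m
  nF+1≡ = begin
    n (branch v K (copyD₃ a b c')) + 1  ≡⟨ cong (_+ 1) (Branch.n-branch v≢0 v∉K v∉G G∩K≡∅ K-NUH G.isNonsingularUHit) ⟩
    suc (n K + n (copyD₃ a b c')) + 1   ≡⟨ cong (λ nG → suc (n K + nG) + 1) G.n≡3 ⟩
    suc (n K + 3) + 1                   ≡⟨ suc[x+3]+1≡[x+1]+4 (n K) ⟩
    (n K + 1) + 4                       ≡⟨ cong (_+ 4) nK+1≡4m ⟩
    4 * m + 4                           ≡⟨ +-comm (4 * m) 4 ⟩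
    4 + 4 * m                           ≡⟨ *-suc 4 m ⟨
    4 * suc m                           ∎


x+1≡4m⇒x≡3+[m∸1]*4 : ∀ {x} m → x + 1 ≡ 4 * m → x ≡ 3 + (m ∸ 1) * 4
x+1≡4m⇒x≡3+[m∸1]*4 {x} zero x+1≡0 = ⊥-elim (m+1+n≢0 x x+1≡0)
x+1≡4m⇒x≡3+[m∸1]*4 {x} (suc m) x+1≡4[1+m] = +-cancelʳ-≡ 1 x (3 + m * 4) (trans x+1≡4[1+m] (4[1+m]≡3+m*4+1 m))
  where
  4[1+m]≡3+m*4+1 : ∀ m → 4 * suc m ≡ 3 + m * 4 + 1
  4[1+m]≡3+m*4+1 = solve-∀

x+1≡4m⇒5m≡x+[m+1] : ∀ {x} m → x + 1 ≡ 4 * m → 5 * m ≡ x + (m + 1)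
x+1≡4m⇒5m≡x+[m+1] {x} m x+1≡4m = trans (cong (λ y → m + y) (sym x+1≡4m)) (m+[x+1]≡x+[m+1] m x)
  where
  m+[x+1]≡x+[m+1] : ∀ m x → m + (x + 1) ≡ x + (m + 1)
  m+[x+1]≡x+[m+1] = solve-∀

∈⇒≤sum : ∀ {u xs} → u ∈ xs → u ≤ sum xs
∈⇒≤sum {xs = x ∷ xs} (here refl) = m≤m+n x (sum xs)
∈⇒≤sum {xs = x ∷ xs} (there u∈xs) = ≤-trans (∈⇒≤sum u∈xs) (m≤n+m (sum xs) x)

IsK-inhabited : ∀ m → ∃ (IsK (suc m))
IsK-inhabited zero = D₃ , base
IsK-inhabited (suc m) with IsK-inhabited m
... | K , K-is-K = _ , step K-is-K (1 + s) (2 + s) (3 + s) (4 + s) (λ ()) (λ ()) (λ ()) (λ ())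
      (m≢1+n+m (1 + s) {0}) (m≢1+n+m (1 + s) {1}) (m≢1+n+m (2 + s) {0})
      (≢-sym (m≢1+n+m (1 + s) {2})) (≢-sym (m≢1+n+m (2 + s) {1})) (≢-sym (m≢1+n+m (3 + s) {0}))
      (fresh 0) (fresh 1) (fresh 2) (fresh 3)
  where
  s : ℕ
  s = sum (vars K)
  fresh : ∀ k → suc (k + s) ∉ vars K
  fresh k 1+k+s∈K = <⇒≱ (s≤s (m≤n+m s k)) (∈⇒≤sum 1+k+s∈K)

4[2+m]∸5≡3+m*4 : ∀ m → 4 * suc (suc m) ∸ 5 ≡ 3 + m * 4
4[2+m]∸5≡3+m*4 m = trans (cong (_∸ 5) (4[2+m]≡5+[3+m*4] m)) (m+n∸m≡n 5 (3 + m * 4))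
  where
  4[2+m]≡5+[3+m*4] : ∀ m → 4 * suc (suc m) ≡ 5 + (3 + m * 4)
  4[2+m]≡5+[3+m*4] = solve-∀

lemma1 : ((m : ℕ) (F : ClauseSet) → IsK m F →
    IsClauseSet F × Nonsingular F × ¬ Satisfiable F × Hitting F
    × δ F ≡ + (m + 1) × n F ≡ 3 + (m ∸ 1) * 4)
    × ((k : ℕ) → 2 ≤ k →
    ∃ λ F → IsClauseSet F × Nonsingular F × ¬ Satisfiable F × Hitting F
    × δ F ≡ + k × 4 * k ∸ 5 ≤ n F)
lemma1 = K-properties , N≥4k-5
  where
  K-properties : (m : ℕ) (F : ClauseSet) → IsK m F →
    IsClauseSet F × Nonsingular F × ¬ Satisfiable F × Hitting F
    × δ F ≡ + (m + 1) × n F ≡ 3 + (m ∸ 1) * 4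
  K-properties m F F-is-K with IsK⇒invariants F-is-K
  ... | F-NUH , cF≡5m , nF+1≡4m =
      IsNonsingularUHit⇒IsClauseSet F-NUH , IsNonsingularUHit⇒Nonsingular F-NUH
    , IsNonsingularUHit.unsatisfiable F-NUH , IsNonsingularUHit.hitting F-NUH
    , c≡n+k⇒δ≡k F (m + 1) (trans cF≡5m (x+1≡4m⇒5m≡x+[m+1] m nF+1≡4m))
    , x+1≡4m⇒x≡3+[m∸1]*4 m nF+1≡4m
  N≥4k-5 : (k : ℕ) → 2 ≤ k →
    ∃ λ F → IsClauseSet F × Nonsingular F × ¬ Satisfiable F × Hitting F
    × δ F ≡ + k × 4 * k ∸ 5 ≤ n F
  N≥4k-5 (suc (suc m)) (s≤s (s≤s z≤n)) with IsK-inhabited m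
  ... | F , F-is-K with K-properties (suc m) F F-is-K
  ... | F-clauseSet , F-nonsingular , F-unsat , F-hitting , δF≡m+2 , nF≡3+4m =
      F , F-clauseSet , F-nonsingular , F-unsat , F-hitting
    , trans δF≡m+2 (cong +_ (+-comm (suc m) 1))
    , ≤-reflexive (trans (4[2+m]∸5≡3+m*4 m) (sym nF≡3+4m))
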